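{- Let $\mathsf{Pred}$ be a finite set of unary predicates, let $S_1,\dots,S_n$ be pairwise distinct state-descriptions over $\mathsf{Pred}$, and let $\mathcal{V}\subseteq\mathbb{N}^n$ be semi-linear. Then there is an $\mathcal{L}^2_\#$ sentence $\varphi$ in the predicates $\mathsf{Pred}$ such that for every finite model $\mathcal{M}$, $\mathcal{M}\models\varphi$ iff $(|S_1|_\mathcal{M},\dots,|S_n|_\mathcal{M})\in\mathcal{V}$. That is, every semi-linear set is definable in $\mathsf{MSO}^\phi(\#)$.
   Context: $\mathcal{L}^2_\#$ is monadic second-order logic with equality over unary predicates: it has individual variables, monadic second-order variables $X$ ranging over all subsets of the domain, atoms $P(x)$, $X(x)$, $x=y$, Boolean connectives, first- and second-order quantifiers, and count comparisons $\#_x\varphi\succsim\#_y\psi$ (arbitrarily nested), true at an assignment iff $|\{d:\varphi\text{ holds with }x\mapsto d\}|\ge|\{d:\psi\text{ holds with }y\mapsto d\}|$. $\mathsf{MSO}^\phi(\#)$ is this logic over finite models. A state-description over $\mathsf{Pred}$ is $\bigwedge_{P\in J}P(x)\wedge\bigwedge_{P\in\mathsf{Pred}\setminus J}\neg P(x)$ for $J\subseteq\mathsf{Pred}$, and $|S|_\mathcal{M}$ is the cardinality of its extension in $\mathcal{M}$. A set $\mathcal{V}\subseteq\mathbb{N}^n$ is linear if there are natural numbers $b_1,\dots,b_n$ and $a_{i,j}$ ($i\le n$, $j\le m$) such that $\mathcal{V}=\{(b_1+\sum_j a_{1,j}u_j,\dots,b_n+\sum_j a_{n,j}u_j): u_1,\dots,u_m\in\mathbb{N}\}$;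 it is semi-linear if it is a finite union of linear sets. -}

module Defs where

open import Data.Bool using (Bool; true; false; _∧_; _∨_; not; T)
open import Data.Nat using (ℕ; zero; suc; _+_; _*_; _≤ᵇ_)
open import Data.Fin using (Fin; _≟_)
open import Data.Fin.Subset using (Subset; ∣_∣)
open import Data.List using (List; []; _∷_; map; _++_)
open import Data.Bool.ListAction using (any; all)
open import Data.List.Relation.Unary.Any using (Any)
open import Data.Vec using (Vec; []; _∷_; lookup; tabulate; allFin)
open import Data.Vec.Functional using () renaming (foldr to foldrF)
open import Data.Product using (Σ; ∃; _×_; _,_)
open import Relation.Nullary using (does)
open import Relation.Binary.PropositionalEquality using (_≡_)

-- Syntax of L²_# over the predicates Pred = Fin p.
-- Formula p i s : formulas whose free individual variables are among
-- Fin i and whose free monadic second-order variables are among Fin s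
-- (de Bruijn indices; binders bind index zero).

data Formula (p : ℕ) : ℕ → ℕ → Set where
  pred  : ∀ {i s} → Fin p → Fin i → Formula p i s
  mem   : ∀ {i s} → Fin s → Fin i → Formula p i s
  eq    : ∀ {i s} → Fin i → Fin i → Formula p i s
  ¬'_   : ∀ {i s} → Formula p i s → Formula p i s
  _∧'_  : ∀ {i s} → Formula p i s → Formula p i s → Formula p i s
  _∨'_  : ∀ {i s} → Formula p i s → Formula p i s → Formula p i s
  ∃₁    : ∀ {i s} → Formula p (suc i) s → Formula p i s
  ∀₁    : ∀ {i s} → Formula p (suc i) s → Formula p i s
  ∃₂    : ∀ {i s} → Formula p i (suc s) → Formula p i s
  ∀₂    : ∀ {i s} → Formula p i (suc s) → Formula p i s
  -- #_x φ ≿ #_y ψ  (x bound in φ, y bound in ψ)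
  cnt   : ∀ {i s} → Formula p (suc i) s → Formula p (suc i) s → Formula p i s

Sentence : ℕ → Set
Sentence p = Formula p 0 0

record Model (p : ℕ) : Set where
  field
    size   : ℕ
    interp : Fin p → Subset (suc size)
open Model public

Dom : ∀ {p} → Model p → ℕ
Dom M = suc (size M)

allSubsets : (n : ℕ) → List (Subset n)
allSubsets zero    = [] ∷ []
allSubsets (suc n) = map (true ∷_) (allSubsets n) ++ map (false ∷_) (allSubsets n)

eval : ∀ {p i s} (M : Model p) → Formula p i s →
       Vec (Fin (Dom M)) i → Vec (Subset (Dom M)) s → Bool
eval M (pred P x) ρ σ = lookup (interp M P) (lookup ρ x)
eval M (mem X x)  ρ σ = lookup (lookup σ X) (lookup ρ x)
eval M (eq x y)   ρ σ = does (lookup ρ x ≟ lookup ρ y)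
eval M (¬' φ)     ρ σ = not (eval M φ ρ σ)
eval M (φ ∧' ψ)   ρ σ = eval M φ ρ σ ∧ eval M ψ ρ σ
eval M (φ ∨' ψ)   ρ σ = eval M φ ρ σ ∨ eval M ψ ρ σ
eval M (∃₁ φ)     ρ σ = Data.Vec.foldr _ _∨_ false (tabulate (λ d → eval M φ (d ∷ ρ) σ))
eval M (∀₁ φ)     ρ σ = Data.Vec.foldr _ _∧_ true (tabulate (λ d → eval M φ (d ∷ ρ) σ))
eval M (∃₂ φ)     ρ σ = any (λ X → eval M φ ρ (X ∷ σ)) (allSubsets (Dom M))
eval M (∀₂ φ)     ρ σ = all (λ X → eval M φ ρ (X ∷ σ)) (allSubsets (Dom M))
eval M (cnt φ ψ)  ρ σ =
  ∣ tabulate (λ d → eval M ψ (d ∷ ρ) σ) ∣ ≤ᵇ ∣ tabulate (λ d → eval M φ (d ∷ ρ) σ) ∣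

_⊨_ : ∀ {p} → Model p → Sentence p → Set
M ⊨ φ = T (eval M φ [] [])

-- State-descriptions: for J ⊆ Pred, the formula (free variable x = index 0)
--   ⋀_{P ∈ J} P(x) ∧ ⋀_{P ∉ J} ¬P(x).
-- The empty conjunction (p = 0) is rendered as x = x.

stateDesc : ∀ {p} → Subset p → Formula p 1 0
stateDesc {p} J = Data.Vec.foldr _ _∧'_ (eq Fin.zero Fin.zero)
  (tabulate (λ P → lit P (lookup J P)))
  where
  lit : Fin p → Bool → Formula p 1 0
  lit P true  = pred P Fin.zero
  lit P false = ¬' pred P Fin.zero

ext-card : ∀ {p} → Model p → Formula p 1 0 → ℕ
ext-card M φ = ∣ tabulate (λ d → eval M φ (d ∷ []) []) ∣

-- Data of a linear set: offset b and m period vectors a_{·,j}.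
record LinearData (n : ℕ) : Set where
  field
    m : ℕ
    b : Fin n → ℕ
    a : Fin n → Fin m → ℕ

sumFin : ∀ {m} → (Fin m → ℕ) → ℕ
sumFin f = foldrF _+_ 0 f

InLinear : ∀ {n} → LinearData n → Vec ℕ n → Set
InLinear {n} L v = Σ (Fin m → ℕ) λ u → ∀ (k : Fin n) →
  lookup v k ≡ b k + sumFin (λ j → a k j * u j)
  where open LinearData L

SemiLinear : ∀ {n} → (Vec ℕ n → Set) → Set
SemiLinear {n} V = Σ (List (LinearData n)) λ Ls →
  ∀ v → (V v → Any (λ L → InLinear L v) Ls) × (Any (λ L → InLinear L v) Ls → V v)

{-# OPTIONS --safe #-}
module Submission where

-- A linear set with offset b and periods a_j is defined by the sentence
--   ∃W ∃X₁ … Xₘ. |W| = 1 ∧ ⋀ₖ |S_k| = b_k·|W| + Σⱼ a_kj·|X_j|,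
-- and a semi-linear set by the disjunction of these sentences. A constraint
-- |θ| = |X_{t₁}| + … + |X_{t_r}| is expressed with a fresh set Y such that |θ ∩ Y| = |X_{t₁}|
-- and, recursively, |θ ∖ Y| = |X_{t₂}| + … + |X_{t_r}|; equicardinality is a pair of counting
-- comparisons, and |W| = 1 says that W is as large as {y | y = x} for some x. Conversely,
-- a membership witness u can be capped to min(u_j, |M|) without changing any a_kj·u_j,
-- since a_kj·u_j ≤ |S_k| ≤ |M|; sets X_j of these sizes then exist in M.

open import Defs
open import Data.Bool using (Bool; true; false; _∧_; _∨_; not; T)
open import Data.Bool.ListAction using (or; and)
open import Data.Bool.Properties using (T-∧; T-∨; T-not-≡)
open import Data.Empty using (⊥-elim)
open import Data.Fin using (Fin; zero; suc; lift; _≟_)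
open import Data.Fin.Subset using (Subset; outside; inside; ⊥; ⊤; ⁅_⁆; ∁; _∩_; ∣_∣)
open import Data.Fin.Subset.Properties using (∣p∣≤n; ∣⊤∣≡n; ∣⊥∣≡0; ∣⁅x⁆∣≡1; ∩-identityˡ; ∩-inverseʳ)
open import Data.List using (List; []; _∷_; map; _++_; replicate)
open import Data.List.Membership.Propositional using (_∈_; lose)
open import Data.List.Membership.Propositional.Properties using (∈-map⁺; ∈-++⁺ˡ; ∈-++⁺ʳ)
open import Data.List.Properties using (map-cong; map-++; map-∘)
open import Data.List.Relation.Unary.Any using (Any; here; there; satisfied)
open import Data.List.Relation.Unary.Any.Properties using (any⁺; any⁻)
open import Data.Nat using (ℕ; zero; suc; _+_; _*_; _⊓_; _≤_; _≤ᵇ_; z≤n; s≤s)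
open import Data.Nat.ListAction using (sum)
open import Data.Nat.ListAction.Properties using (sum-++)
open import Data.Nat.Properties
  using (≤ᵇ⇒≤; ≤⇒≤ᵇ; ≤-antisym; ≤-reflexive; ≤-trans; +-suc; +-cancelˡ-≡; *-identityʳ;
         m≤m+n; m≤n+m; m⊓n≤n; m≤n⇒m⊓n≡m)
open import Data.Product using (Σ; ∃; _×_; _,_; proj₁; proj₂)
open import Data.Sum using (inj₁; inj₂; [_,_]′)
open import Data.Vec using (Vec; []; _∷_; lookup; tabulate; zipWith; foldr)
open import Data.Vec.Properties
  using (tabulate-cong; tabulate-∘; tabulate∘lookup; lookup∘tabulate; map-const)
open import Function using (_∘_; id; const; _⇔_; mk⇔; Equivalence)
open import Function.Definitions using (Injective)
open import Function.Properties.Equivalence using () renaming (trans to ⇔-trans)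
open import Relation.Binary.PropositionalEquality
  using (_≡_; refl; sym; trans; cong; cong₂; subst; module ≡-Reasoning)
open import Relation.Nullary using (does; ¬_)

open Equivalence using (to; from)

private
  variable
    p i s s′ n : ℕ

tabulate-zipWith : ∀ {A B C : Set} (f : A → B → C) (g : Fin n → A) (h : Fin n → B) →
                   tabulate (λ d → f (g d) (h d)) ≡ zipWith f (tabulate g) (tabulate h)
tabulate-zipWith {n = zero}  f g h = refl
tabulate-zipWith {n = suc n} f g h =
  cong (f (g zero) (h zero) ∷_) (tabulate-zipWith f (g ∘ suc) (h ∘ suc))

tabulate-≟ : (d : Fin n) → tabulate (λ e → does (e ≟ d)) ≡ ⁅ d ⁆
tabulate-≟ zero    = cong (inside ∷_) (trans (tabulate-∘ (const outside) id) (map-const _ outside))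
tabulate-≟ (suc d) = cong (outside ∷_) (tabulate-≟ d)

T-or-tabulate : (g : Fin n → Bool) → T (foldr _ _∨_ false (tabulate g)) ⇔ ∃ (T ∘ g)
T-or-tabulate {n = zero}  g = mk⇔ (λ ()) (λ ())
T-or-tabulate {n = suc n} g = mk⇔
  (λ h → [ (zero ,_) , (λ (d , gd) → suc d , gd) ∘ to (T-or-tabulate (g ∘ suc)) ]′ (to T-∨ h))
  (λ { (zero , g0) → from T-∨ (inj₁ g0)
     ; (suc d , gd) → from T-∨ (inj₂ (from (T-or-tabulate (g ∘ suc)) (d , gd))) })

lift-compatible : ∀ {A : Set} (f : Fin s → Fin s′) {σ : Vec A s} {σ′ : Vec A s′} →
                  (∀ X → lookup σ′ (f X) ≡ lookup σ X) →
                  ∀ Y X → lookup (Y ∷ σ′) (lift 1 f X) ≡ lookup (Y ∷ σ) X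
lift-compatible f h Y zero    = refl
lift-compatible f h Y (suc X) = h X

∈-allSubsets : (X : Subset n) → X ∈ allSubsets n
∈-allSubsets []            = here refl
∈-allSubsets (inside ∷ X)  = ∈-++⁺ˡ (∈-map⁺ (inside ∷_) (∈-allSubsets X))
∈-allSubsets {suc n} (outside ∷ X) =
  ∈-++⁺ʳ (map (inside ∷_) (allSubsets n)) (∈-map⁺ (outside ∷_) (∈-allSubsets X))

∣p∣≡∣p∩q∣+∣p∩∁q∣ : (p q : Subset n) → ∣ p ∣ ≡ ∣ p ∩ q ∣ + ∣ p ∩ ∁ q ∣
∣p∣≡∣p∩q∣+∣p∩∁q∣ []            []            = refl
∣p∣≡∣p∩q∣+∣p∩∁q∣ (outside ∷ p) (_ ∷ q)       = ∣p∣≡∣p∩q∣+∣p∩∁q∣ p q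
∣p∣≡∣p∩q∣+∣p∩∁q∣ (inside ∷ p)  (inside ∷ q)  = cong suc (∣p∣≡∣p∩q∣+∣p∩∁q∣ p q)
∣p∣≡∣p∩q∣+∣p∩∁q∣ (inside ∷ p)  (outside ∷ q) =
  trans (cong suc (∣p∣≡∣p∩q∣+∣p∩∁q∣ p q)) (sym (+-suc ∣ p ∩ q ∣ ∣ p ∩ ∁ q ∣))

∃[∣p∩q∣≡a] : (p : Subset n) {a : ℕ} → a ≤ ∣ p ∣ → ∃ λ q → ∣ p ∩ q ∣ ≡ a
∃[∣p∩q∣≡a] []            z≤n       = [] , refl
∃[∣p∩q∣≡a] (outside ∷ p) a≤∣p∣     = let q , e = ∃[∣p∩q∣≡a] p a≤∣p∣ in outside ∷ q , e
∃[∣p∩q∣≡a] (inside ∷ p)  z≤n       = let q , e = ∃[∣p∩q∣≡a] p z≤n in outside ∷ q , e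
∃[∣p∩q∣≡a] (inside ∷ p)  (s≤s a≤∣p∣) = let q , e = ∃[∣p∩q∣≡a] p a≤∣p∣ in inside ∷ q , cong suc e

∃[∣q∣≡a] : {a : ℕ} → a ≤ n → ∃ λ (q : Subset n) → ∣ q ∣ ≡ a
∃[∣q∣≡a] {n} a≤n =
  let q , e = ∃[∣p∩q∣≡a] ⊤ (subst (_ ≤_) (sym (∣⊤∣≡n n)) a≤n)
  in q , trans (cong ∣_∣ (sym (∩-identityˡ q))) e

subsetsOfSizes : ∀ {m} (u : Fin m → ℕ) → (∀ j → u j ≤ n) →
                 Σ (Vec (Subset n) m) λ Xs → ∀ j → ∣ lookup Xs j ∣ ≡ u j
subsetsOfSizes u u≤n =
  tabulate (λ j → proj₁ (∃[∣q∣≡a] (u≤n j))) ,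
  λ j → trans (cong ∣_∣ (lookup∘tabulate _ j)) (proj₂ (∃[∣q∣≡a] (u≤n j)))

∣p∣≡a+b⇔split : (p : Subset n) {a b : ℕ} →
                ∣ p ∣ ≡ a + b ⇔ ∃ λ q → ∣ p ∩ q ∣ ≡ a × ∣ p ∩ ∁ q ∣ ≡ b
∣p∣≡a+b⇔split p {a} {b} = mk⇔ split (λ (q , ea , eb) → trans (∣p∣≡∣p∩q∣+∣p∩∁q∣ p q) (cong₂ _+_ ea eb))
  where
  split : ∣ p ∣ ≡ a + b → ∃ λ q → ∣ p ∩ q ∣ ≡ a × ∣ p ∩ ∁ q ∣ ≡ b
  split ∣p∣≡a+b with ∃[∣p∩q∣≡a] p (subst (a ≤_) (sym ∣p∣≡a+b) (m≤m+n a b))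
  ... | q , ∣p∩q∣≡a = q , ∣p∩q∣≡a , +-cancelˡ-≡ a _ _ (begin
      a + ∣ p ∩ ∁ q ∣             ≡⟨ cong (_+ ∣ p ∩ ∁ q ∣) (sym ∣p∩q∣≡a) ⟩
      ∣ p ∩ q ∣ + ∣ p ∩ ∁ q ∣     ≡⟨ sym (∣p∣≡∣p∩q∣+∣p∩∁q∣ p q) ⟩
      ∣ p ∣                       ≡⟨ ∣p∣≡a+b ⟩
      a + b                       ∎)
    where open ≡-Reasoning

sumFin-cong : {f g : Fin n → ℕ} → (∀ j → f j ≡ g j) → sumFin f ≡ sumFin g
sumFin-cong {n = zero}  f≗g = refl
sumFin-cong {n = suc n} f≗g = cong₂ _+_ (f≗g zero) (sumFin-cong (f≗g ∘ suc))

f≤sumFin : (f : Fin n → ℕ) (j : Fin n) → f j ≤ sumFin f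
f≤sumFin f zero    = m≤m+n (f zero) _
f≤sumFin f (suc j) = ≤-trans (f≤sumFin (f ∘ suc) j) (m≤n+m _ (f zero))

copies : (Fin n → ℕ) → List (Fin n)
copies {n = zero}  c = []
copies {n = suc n} c = replicate (c zero) zero ++ map suc (copies (c ∘ suc))

sum-map-replicate : {A : Set} (g : A → ℕ) (r : ℕ) (x : A) → sum (map g (replicate r x)) ≡ r * g x
sum-map-replicate g zero    x = refl
sum-map-replicate g (suc r) x = cong (g x +_) (sum-map-replicate g r x)

sum-map-copies : (c g : Fin n → ℕ) → sum (map g (copies c)) ≡ sumFin (λ t → c t * g t)
sum-map-copies {n = zero}  c g = refl
sum-map-copies {n = suc n} c g = begin
  sum (map g (replicate (c zero) zero ++ map suc (copies (c ∘ suc))))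
    ≡⟨ cong sum (map-++ g (replicate (c zero) zero) _) ⟩
  sum (map g (replicate (c zero) zero) ++ map g (map suc (copies (c ∘ suc))))
    ≡⟨ sum-++ (map g (replicate (c zero) zero)) _ ⟩
  sum (map g (replicate (c zero) zero)) + sum (map g (map suc (copies (c ∘ suc))))
    ≡⟨ cong₂ _+_ (sum-map-replicate g (c zero) zero) (cong sum (sym (map-∘ (copies (c ∘ suc))))) ⟩
  c zero * g zero + sum (map (g ∘ suc) (copies (c ∘ suc)))
    ≡⟨ cong (c zero * g zero +_) (sum-map-copies (c ∘ suc) (g ∘ suc)) ⟩
  c zero * g zero + sumFin (λ t → c (suc t) * g (suc t))
    ∎
  where open ≡-Reasoning

m*n≤o⇒m*[n⊓o]≡m*n : (m n o : ℕ) → m * n ≤ o → m * (n ⊓ o) ≡ m * n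
m*n≤o⇒m*[n⊓o]≡m*n zero    n o _      = refl
m*n≤o⇒m*[n⊓o]≡m*n (suc m) n o m*n≤o = cong (suc m *_) (m≤n⇒m⊓n≡m (≤-trans (m≤m+n n (m * n)) m*n≤o))

InLinear⇒boundedWitness : ∀ (L : LinearData n) {N} {v : Vec ℕ n} → (∀ k → lookup v k ≤ N) →
                          InLinear L v → Σ (InLinear L v) λ (u , _) → ∀ j → u j ≤ N
InLinear⇒boundedWitness L {N} {v} v≤N (u , v≡) =
  ((λ j → u j ⊓ N) , λ k → trans (v≡ k) (cong (b k +_) (sumFin-cong λ j →
     sym (m*n≤o⇒m*[n⊓o]≡m*n (a k j) (u j) N (a*u≤N k j))))) ,
  λ j → m⊓n≤n (u j) N
  where
  open LinearData L
  a*u≤N : ∀ k j → a k j * u j ≤ N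
  a*u≤N k j = ≤-trans (f≤sumFin (λ j → a k j * u j) j)
                (≤-trans (m≤n+m _ (b k)) (subst (_≤ N) (v≡ k) (v≤N k)))

rename : (Fin s → Fin s′) → Formula p i s → Formula p i s′
rename f (pred P x) = pred P x
rename f (mem X x)  = mem (f X) x
rename f (eq x y)   = eq x y
rename f (¬' φ)     = ¬' rename f φ
rename f (φ ∧' ψ)   = rename f φ ∧' rename f ψ
rename f (φ ∨' ψ)   = rename f φ ∨' rename f ψ
rename f (∃₁ φ)     = ∃₁ (rename f φ)
rename f (∀₁ φ)     = ∀₁ (rename f φ)
rename f (∃₂ φ)     = ∃₂ (rename (lift 1 f) φ)
rename f (∀₂ φ)     = ∀₂ (rename (lift 1 f) φ)
rename f (cnt φ ψ)  = cnt (rename f φ) (rename f ψ)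

weaken : Formula p i 0 → Formula p i s
weaken = rename (λ ())

sameSize : Formula p (suc i) s → Formula p (suc i) s → Formula p i s
sameSize φ ψ = cnt φ ψ ∧' cnt ψ φ

⊤′ : Formula p i s
⊤′ = ∃₁ (eq zero zero)

⊥′ : Formula p i s
⊥′ = ¬' ⊤′

⋀ : ∀ {k} → (Fin k → Formula p i s) → Formula p i s
⋀ {k = zero}  φs = ⊤′
⋀ {k = suc k} φs = φs zero ∧' ⋀ (φs ∘ suc)

∃₂* : ∀ m → Formula p i m → Formula p i 0
∃₂* zero    φ = φ
∃₂* (suc m) φ = ∃₂* m (∃₂ φ)

isSingleton : Fin s → Formula p i s
isSingleton X = ∃₁ (sameSize (mem X zero) (eq zero (suc zero)))

_∩′_ : Formula p (suc i) s → Fin s → Formula p (suc i) s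
φ ∩′ X = φ ∧' mem X zero

_∖′_ : Formula p (suc i) s → Fin s → Formula p (suc i) s
φ ∖′ X = φ ∧' (¬' mem X zero)

-- f re-indexes the summands past the set variables bound by earlier cuts.
sumEq : ∀ {s₀} → List (Fin s₀) → (Fin s₀ → Fin s) → Formula p (suc i) s → Formula p i s
sumEq []       f θ = sameSize θ (θ ∧' (¬' θ))
sumEq (t ∷ ts) f θ =
  ∃₂ (sameSize (rename suc θ ∩′ zero) (mem (suc (f t)) zero)
      ∧' sumEq ts (suc ∘ f) (rename suc θ ∖′ zero))

module Semantics {p} (M : Model p) where

  ⟦_⟧ : Formula p i s → Vec (Fin (Dom M)) i → Vec (Subset (Dom M)) s → Set
  ⟦ φ ⟧ ρ σ = T (eval M φ ρ σ)

  ext : Formula p (suc i) s → Vec (Fin (Dom M)) i → Vec (Subset (Dom M)) s → Subset (Dom M)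
  ext φ ρ σ = tabulate (λ d → eval M φ (d ∷ ρ) σ)

  eval-rename : ∀ (f : Fin s → Fin s′) (φ : Formula p i s) ρ σ σ′ →
                (∀ X → lookup σ′ (f X) ≡ lookup σ X) → eval M (rename f φ) ρ σ′ ≡ eval M φ ρ σ
  eval-rename f (pred P x) ρ σ σ′ h = refl
  eval-rename f (mem X x)  ρ σ σ′ h = cong (λ Y → lookup Y (lookup ρ x)) (h X)
  eval-rename f (eq x y)   ρ σ σ′ h = refl
  eval-rename f (¬' φ)     ρ σ σ′ h = cong not (eval-rename f φ ρ σ σ′ h)
  eval-rename f (φ ∧' ψ)   ρ σ σ′ h = cong₂ _∧_ (eval-rename f φ ρ σ σ′ h) (eval-rename f ψ ρ σ σ′ h)
  eval-rename f (φ ∨' ψ)   ρ σ σ′ h = cong₂ _∨_ (eval-rename f φ ρ σ σ′ h) (eval-rename f ψ ρ σ σ′ h)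
  eval-rename f (∃₁ φ)     ρ σ σ′ h =
    cong (foldr _ _∨_ false) (tabulate-cong λ d → eval-rename f φ (d ∷ ρ) σ σ′ h)
  eval-rename f (∀₁ φ)     ρ σ σ′ h =
    cong (foldr _ _∧_ true) (tabulate-cong λ d → eval-rename f φ (d ∷ ρ) σ σ′ h)
  eval-rename f (∃₂ φ)     ρ σ σ′ h =
    cong or (map-cong (λ X → eval-rename (lift 1 f) φ ρ (X ∷ σ) (X ∷ σ′) (lift-compatible f h X))
                      (allSubsets (Dom M)))
  eval-rename f (∀₂ φ)     ρ σ σ′ h =
    cong and (map-cong (λ X → eval-rename (lift 1 f) φ ρ (X ∷ σ) (X ∷ σ′) (lift-compatible f h X))
                       (allSubsets (Dom M)))
  eval-rename f (cnt φ ψ)  ρ σ σ′ h =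
    cong₂ (λ φs ψs → ∣ ψs ∣ ≤ᵇ ∣ φs ∣) (tabulate-cong λ d → eval-rename f φ (d ∷ ρ) σ σ′ h)
                                       (tabulate-cong λ d → eval-rename f ψ (d ∷ ρ) σ σ′ h)

  module _ {ρ : Vec (Fin (Dom M)) i} where

    ext-∧ : ∀ {σ} (φ ψ : Formula p (suc i) s) → ext (φ ∧' ψ) ρ σ ≡ ext φ ρ σ ∩ ext ψ ρ σ
    ext-∧ {σ = σ} φ ψ = tabulate-zipWith _∧_ (λ d → eval M φ (d ∷ ρ) σ) (λ d → eval M ψ (d ∷ ρ) σ)

    ext-¬ : ∀ {σ} (φ : Formula p (suc i) s) → ext (¬' φ) ρ σ ≡ ∁ (ext φ ρ σ)
    ext-¬ {σ = σ} φ = tabulate-∘ not (λ d → eval M φ (d ∷ ρ) σ)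

    ext-mem : (σ : Vec (Subset (Dom M)) s) (X : Fin s) → ext (mem X zero) ρ σ ≡ lookup σ X
    ext-mem σ X = tabulate∘lookup (lookup σ X)

    ext-weaken : ∀ {σ : Vec (Subset (Dom M)) s} (φ : Formula p (suc i) 0) →
                 ext (weaken φ) ρ σ ≡ ext φ ρ []
    ext-weaken {σ = σ} φ = tabulate-cong λ d → eval-rename (λ ()) φ (d ∷ ρ) [] σ (λ ())

    ext-rename-suc : ∀ {σ Y} (φ : Formula p (suc i) s) → ext (rename suc φ) ρ (Y ∷ σ) ≡ ext φ ρ σ
    ext-rename-suc {σ = σ} {Y} φ = tabulate-cong λ d → eval-rename suc φ (d ∷ ρ) σ (Y ∷ σ) (λ _ → refl)

    ext-∩′ : ∀ {σ} (φ : Formula p (suc i) s) (X : Fin s) → ext (φ ∩′ X) ρ σ ≡ ext φ ρ σ ∩ lookup σ X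
    ext-∩′ {σ = σ} φ X = trans (ext-∧ φ (mem X zero)) (cong (ext φ ρ σ ∩_) (ext-mem σ X))

    ext-∖′ : ∀ {σ} (φ : Formula p (suc i) s) (X : Fin s) → ext (φ ∖′ X) ρ σ ≡ ext φ ρ σ ∩ ∁ (lookup σ X)
    ext-∖′ {σ = σ} φ X = trans (ext-∧ φ (¬' mem X zero))
      (cong (ext φ ρ σ ∩_) (trans (ext-¬ {σ = σ} (mem X zero)) (cong ∁ (ext-mem σ X))))

  ext-eq : ∀ {ρ : Vec (Fin (Dom M)) i} {σ : Vec (Subset (Dom M)) s} (d : Fin (Dom M)) →
           ext (eq zero (suc zero)) (d ∷ ρ) σ ≡ ⁅ d ⁆
  ext-eq d = tabulate-≟ d

  module _ {ρ : Vec (Fin (Dom M)) i} {σ : Vec (Subset (Dom M)) s} where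

    ⟦∃₁⟧ : (φ : Formula p (suc i) s) → ⟦ ∃₁ φ ⟧ ρ σ ⇔ ∃ λ d → ⟦ φ ⟧ (d ∷ ρ) σ
    ⟦∃₁⟧ φ = T-or-tabulate (λ d → eval M φ (d ∷ ρ) σ)

    ⟦∃₂⟧ : (φ : Formula p i (suc s)) → ⟦ ∃₂ φ ⟧ ρ σ ⇔ ∃ λ X → ⟦ φ ⟧ ρ (X ∷ σ)
    ⟦∃₂⟧ φ = mk⇔ (satisfied ∘ any⁻ _ (allSubsets (Dom M)))
                 (λ (X , φX) → any⁺ _ (lose (∈-allSubsets X) φX))

    ⟦sameSize⟧ : ∀ (φ ψ : Formula p (suc i) s) {a b} → ∣ ext φ ρ σ ∣ ≡ a → ∣ ext ψ ρ σ ∣ ≡ b →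
                 ⟦ sameSize φ ψ ⟧ ρ σ ⇔ (a ≡ b)
    ⟦sameSize⟧ φ ψ refl refl = mk⇔
      (λ h → let ψ≤φ , φ≤ψ = to T-∧ h in ≤-antisym (≤ᵇ⇒≤ _ _ φ≤ψ) (≤ᵇ⇒≤ _ _ ψ≤φ))
      (λ φ≡ψ → from T-∧ (≤⇒≤ᵇ (≤-reflexive (sym φ≡ψ)) , ≤⇒≤ᵇ (≤-reflexive φ≡ψ)))

    ⊨⊤′ : ⟦ ⊤′ ⟧ ρ σ
    ⊨⊤′ = from (⟦∃₁⟧ (eq zero zero)) (zero , _)

    ⊭⊥′ : ¬ ⟦ ⊥′ ⟧ ρ σ
    ⊭⊥′ h = subst T (to T-not-≡ h) ⊨⊤′

    ⟦⋀⟧ : ∀ {k} (φs : Fin k → Formula p i s) → ⟦ ⋀ φs ⟧ ρ σ ⇔ (∀ j → ⟦ φs j ⟧ ρ σ)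
    ⟦⋀⟧ {k = zero}  φs = mk⇔ (λ _ ()) (λ _ → ⊨⊤′)
    ⟦⋀⟧ {k = suc k} φs = mk⇔
      (λ h → let h₀ , hs = to T-∧ h in λ { zero → h₀ ; (suc j) → to (⟦⋀⟧ (φs ∘ suc)) hs j })
      (λ h → from T-∧ (h zero , from (⟦⋀⟧ (φs ∘ suc)) (h ∘ suc)))

  ⟦isSingleton⟧ : ∀ {i s} {ρ : Vec (Fin (Dom M)) i} {σ : Vec (Subset (Dom M)) s} (X : Fin s) →
                  ⟦ isSingleton X ⟧ ρ σ ⇔ (∣ lookup σ X ∣ ≡ 1)
  ⟦isSingleton⟧ {i} {s} {ρ} {σ} X = mk⇔
    (λ h → let d , h′ = to (⟦∃₁⟧ {ρ = ρ} {σ} X≈⁅x⁆) h in trans (to (X≈⁅d⁆⇔ d) h′) (∣⁅x⁆∣≡1 d))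
    (λ ∣X∣≡1 → from (⟦∃₁⟧ {ρ = ρ} {σ} X≈⁅x⁆)
                    (zero , from (X≈⁅d⁆⇔ zero) (trans ∣X∣≡1 (sym (∣⁅x⁆∣≡1 {n = Dom M} zero)))))
    where
    X≈⁅x⁆ : Formula p (suc i) s
    X≈⁅x⁆ = sameSize (mem X zero) (eq zero (suc zero))
    X≈⁅d⁆⇔ : ∀ d → ⟦ X≈⁅x⁆ ⟧ (d ∷ ρ) σ ⇔ (∣ lookup σ X ∣ ≡ ∣ ⁅ d ⁆ ∣)
    X≈⁅d⁆⇔ d = ⟦sameSize⟧ {ρ = d ∷ ρ} {σ} (mem X zero) (eq zero (suc zero))
                     (cong ∣_∣ (ext-mem {ρ = d ∷ ρ} σ X)) (cong ∣_∣ (ext-eq {ρ = ρ} {σ} d))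

  ⟦∃₂*⟧ : ∀ {ρ : Vec (Fin (Dom M)) i} m (φ : Formula p i m) → ⟦ ∃₂* m φ ⟧ ρ [] ⇔ ∃ λ σ → ⟦ φ ⟧ ρ σ
  ⟦∃₂*⟧ zero    φ = mk⇔ ([] ,_) λ { ([] , h) → h }
  ⟦∃₂*⟧ (suc m) φ = mk⇔
    (λ h → let σ , h′ = to (⟦∃₂*⟧ m (∃₂ φ)) h ; X , h″ = to (⟦∃₂⟧ φ) h′ in X ∷ σ , h″)
    (λ { (X ∷ σ , h) → from (⟦∃₂*⟧ m (∃₂ φ)) (σ , from (⟦∃₂⟧ φ) (X , h)) })

  ⟦sumEq⟧ : ∀ {i s s₀} {ρ : Vec (Fin (Dom M)) i} {σ : Vec (Subset (Dom M)) s}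
            (ts : List (Fin s₀)) (f : Fin s₀ → Fin s) (θ : Formula p (suc i) s) {A} → ext θ ρ σ ≡ A →
            ⟦ sumEq ts f θ ⟧ ρ σ ⇔ (∣ A ∣ ≡ sum (map (λ t → ∣ lookup σ (f t) ∣) ts))
  ⟦sumEq⟧ {ρ = ρ} {σ} [] f θ refl =
    ⟦sameSize⟧ {ρ = ρ} {σ} θ (θ ∧' (¬' θ)) refl (trans (cong ∣_∣ θ∧¬θ≡⊥) (∣⊥∣≡0 (Dom M)))
    where
    θ∧¬θ≡⊥ : ext (θ ∧' (¬' θ)) ρ σ ≡ ⊥
    θ∧¬θ≡⊥ = trans (ext-∧ θ (¬' θ)) (trans (cong (ext θ ρ σ ∩_) (ext-¬ θ)) (∩-inverseʳ (ext θ ρ σ)))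
  ⟦sumEq⟧ {i} {s} {ρ = ρ} {σ} (t ∷ ts) f θ refl = mk⇔
    (λ h → let Y , h′ = to (⟦∃₂⟧ {ρ = ρ} {σ} cut∧rest) h ; c , r = to T-∧ h′ in
           from (∣p∣≡a+b⇔split (ext θ ρ σ)) (Y , to (cut⇔ Y) c , to (rest⇔ Y) r))
    (λ e → let Y , c , r = to (∣p∣≡a+b⇔split (ext θ ρ σ)) e in
           from (⟦∃₂⟧ {ρ = ρ} {σ} cut∧rest) (Y , from T-∧ (from (cut⇔ Y) c , from (rest⇔ Y) r)))
    where
    cut : Formula p i (suc s)
    cut = sameSize (rename suc θ ∩′ zero) (mem (suc (f t)) zero)
    rest : Formula p i (suc s)
    rest = sumEq ts (suc ∘ f) (rename suc θ ∖′ zero)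
    cut∧rest : Formula p i (suc s)
    cut∧rest = cut ∧' rest
    cut⇔ : ∀ Y → ⟦ cut ⟧ ρ (Y ∷ σ) ⇔ (∣ ext θ ρ σ ∩ Y ∣ ≡ ∣ lookup σ (f t) ∣)
    cut⇔ Y = ⟦sameSize⟧ {ρ = ρ} {Y ∷ σ} (rename suc θ ∩′ zero) (mem (suc (f t)) zero)
      (cong ∣_∣ (trans (ext-∩′ (rename suc θ) zero) (cong (_∩ Y) (ext-rename-suc {Y = Y} θ))))
      (cong ∣_∣ (ext-mem {ρ = ρ} (Y ∷ σ) (suc (f t))))
    rest⇔ : ∀ Y → ⟦ rest ⟧ ρ (Y ∷ σ) ⇔ (∣ ext θ ρ σ ∩ ∁ Y ∣ ≡ sum (map (λ t → ∣ lookup σ (f t) ∣) ts))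
    rest⇔ Y = ⟦sumEq⟧ ts (suc ∘ f) (rename suc θ ∖′ zero)
      (trans (ext-∖′ (rename suc θ) zero) (cong (_∩ ∁ Y) (ext-rename-suc {Y = Y} θ)))

module _ {p n} (J : Fin n → Subset p) where

  counts : Model p → Vec ℕ n
  counts M = tabulate (λ k → ext-card M (stateDesc (J k)))

  coefficients : (L : LinearData n) → Fin n → Fin (suc (LinearData.m L)) → ℕ
  coefficients L k zero    = LinearData.b L k
  coefficients L k (suc j) = LinearData.a L k j

  stateSizeEq : (L : LinearData n) → Fin n → Formula p 0 (suc (LinearData.m L))
  stateSizeEq L k = sumEq (copies (coefficients L k)) id (weaken (stateDesc (J k)))

  linearBody : (L : LinearData n) → Formula p 0 (suc (LinearData.m L))
  linearBody L = isSingleton zero ∧' ⋀ (stateSizeEq L)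

  linear : LinearData n → Sentence p
  linear L = ∃₂* (suc (LinearData.m L)) (linearBody L)

  semilinear : List (LinearData n) → Sentence p
  semilinear []       = ⊥′
  semilinear (L ∷ Ls) = linear L ∨' semilinear Ls

  module _ (M : Model p) where
    open Semantics M

    lookup-counts : ∀ k → lookup (counts M) k ≡ ext-card M (stateDesc (J k))
    lookup-counts = lookup∘tabulate (λ k → ext-card M (stateDesc (J k)))

    counts≤Dom : ∀ k → lookup (counts M) k ≤ Dom M
    counts≤Dom k = subst (_≤ Dom M) (sym (lookup-counts k)) (∣p∣≤n (ext (stateDesc (J k)) [] []))

    ⟦stateSizeEq⟧ : ∀ L k (W : Subset (Dom M)) (Xs : Vec (Subset (Dom M)) (LinearData.m L)) → ∣ W ∣ ≡ 1 →
                    let open LinearData L in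
                    ⟦ stateSizeEq L k ⟧ [] (W ∷ Xs)
                    ⇔ (lookup (counts M) k ≡ b k + sumFin (λ j → a k j * ∣ lookup Xs j ∣))
    ⟦stateSizeEq⟧ L k W Xs ∣W∣≡1 = ⇔-trans
      (⟦sumEq⟧ {σ = W ∷ Xs} (copies (coefficients L k)) id (weaken S) (ext-weaken S))
      (mk⇔ (λ e → trans (lookup-counts k) (trans e sum≡))
           (λ e → trans (sym (lookup-counts k)) (trans e (sym sum≡))))
      where
      open LinearData L
      S : Formula p 1 0
      S = stateDesc (J k)
      sum≡ : sum (map (λ t → ∣ lookup (W ∷ Xs) t ∣) (copies (coefficients L k)))
             ≡ b k + sumFin (λ j → a k j * ∣ lookup Xs j ∣)
      sum≡ = trans (sum-map-copies (coefficients L k) (λ t → ∣ lookup (W ∷ Xs) t ∣))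
                   (cong (_+ sumFin (λ j → a k j * ∣ lookup Xs j ∣))
                         (trans (cong (b k *_) ∣W∣≡1) (*-identityʳ (b k))))

    ⟦linear⟧ : ∀ L → M ⊨ linear L ⇔ InLinear L (counts M)
    ⟦linear⟧ L = mk⇔ sound complete
      where
      open LinearData L
      sound : M ⊨ linear L → InLinear L (counts M)
      sound h with to (⟦∃₂*⟧ (suc m) (linearBody L)) h
      ... | W ∷ Xs , h′ =
        let ∣W∣≡1 , eqs = to T-∧ h′ in
        (λ j → ∣ lookup Xs j ∣) ,
        λ k → to (⟦stateSizeEq⟧ L k W Xs (to (⟦isSingleton⟧ {ρ = []} {W ∷ Xs} zero) ∣W∣≡1))
                 (to (⟦⋀⟧ {ρ = []} {W ∷ Xs} (stateSizeEq L)) eqs k)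
      complete : InLinear L (counts M) → M ⊨ linear L
      complete v∈L with InLinear⇒boundedWitness L {v = counts M} counts≤Dom v∈L
      ... | (u , v≡) , u≤Dom with subsetsOfSizes u u≤Dom
      ... | Xs , ∣Xs∣≡u =
        from (⟦∃₂*⟧ (suc m) (linearBody L)) (⁅ zero ⁆ ∷ Xs , from T-∧
          (from (⟦isSingleton⟧ {ρ = []} {⁅ zero ⁆ ∷ Xs} zero) (∣⁅x⁆∣≡1 {n = Dom M} zero) ,
           from (⟦⋀⟧ {ρ = []} {⁅ zero ⁆ ∷ Xs} (stateSizeEq L)) λ k →
             from (⟦stateSizeEq⟧ L k ⁅ zero ⁆ Xs (∣⁅x⁆∣≡1 {n = Dom M} zero))
                  (trans (v≡ k) (cong (b k +_) (sumFin-cong λ j → cong (a k j *_) (sym (∣Xs∣≡u j)))))))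

    ⟦semilinear⟧ : ∀ Ls → M ⊨ semilinear Ls ⇔ Any (λ L → InLinear L (counts M)) Ls
    ⟦semilinear⟧ []       = mk⇔ (⊥-elim ∘ ⊭⊥′ {ρ = []} {[]}) λ ()
    ⟦semilinear⟧ (L ∷ Ls) = mk⇔
      (λ h → [ here ∘ to (⟦linear⟧ L) , there ∘ to (⟦semilinear⟧ Ls) ]′ (to T-∨ h))
      (λ { (here  x) → from T-∨ (inj₁ (from (⟦linear⟧ L) x))
         ; (there x) → from T-∨ (inj₂ (from (⟦semilinear⟧ Ls) x)) })

-- Distinctness of the state-descriptions is not needed: the sentence works for any family J.
lemma4p5 : ∀ {p n} (J : Fin n → Subset p) → Injective _≡_ _≡_ J →
    (V : Vec ℕ n → Set) → SemiLinear V →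
    Σ (Sentence p) λ φ → ∀ (M : Model p) →
      (M ⊨ φ → V (tabulate (λ k → ext-card M (stateDesc (J k)))))
      × (V (tabulate (λ k → ext-card M (stateDesc (J k)))) → M ⊨ φ)
lemma4p5 J _ V (Ls , V⇔Ls) = semilinear J Ls , λ M →
  (λ M⊨φ → proj₂ (V⇔Ls _) (to (⟦semilinear⟧ J M Ls) M⊨φ)) ,
  (λ v∈V → from (⟦semilinear⟧ J M Ls) (proj₁ (V⇔Ls _) v∈V))
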